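{- Fix an odd integer $l=2m+1$ with $m>0$. For all integers $i,j$, $$[i]^4[2j]+[j]^4[2i]+[2i][2j]+[i+j]^2[i-j]^2=0$$ in $\mathbb{Z}/2[[x]]$.
   Context: For an integer $i$, $[i]=\sum x^{n^2}\in\mathbb{Z}/2[[x]]$, summed over all $n\in\mathbb{Z}$ with $n\equiv i\pmod l$. -}

module Defs where

open import Data.Bool using (Bool; true; false; _xor_; _∧_; if_then_else_)
open import Data.Nat as ℕ using (ℕ; zero; suc; _∸_)
open import Data.Nat.Divisibility using (_∣?_)
open import Data.Integer as ℤ using (ℤ; +_; ∣_∣)
open import Data.List using (List; map; foldr; upTo)
open import Relation.Nullary.Decidable using (⌊_⌋)
open import Relation.Binary.PropositionalEquality using (_≡_)

-- Formal power series over ℤ/2: the k-th coefficient (true = 1, false = 0).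
PS : Set
PS = ℕ → Bool

⊕-sum : List Bool → Bool
⊕-sum = foldr _xor_ false

infixl 6 _⊕_
infixl 7 _⊛_

_⊕_ : PS → PS → PS
(f ⊕ g) k = f k xor g k

_⊛_ : PS → PS → PS
(f ⊛ g) k = ⊕-sum (map (λ a → f a ∧ g (k ∸ a)) (upTo (suc k)))

one : PS
one zero    = true
one (suc _) = false

_^ᵖ_ : PS → ℕ → PS
f ^ᵖ zero  = one
f ^ᵖ suc n = f ⊛ (f ^ᵖ n)

-- the integers -k, ..., k (every n ∈ ℤ with n² = k lies in this range)
range : ℕ → List ℤ
range k = map (λ a → (+ a) ℤ.- (+ k)) (upTo (suc (2 ℕ.* k)))

-- [i] for modulus l: coefficient of x^k is the number (mod 2) of n ∈ ℤ with
-- n ≡ i (mod l) and n² = k.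
theta : ℕ → ℤ → PS
theta l i k = ⊕-sum (map (λ n → ⌊ ∣ n ℤ.* n ℤ.- (+ k) ∣ ℕ.≟ 0 ⌋ ∧ ⌊ l ∣? ∣ n ℤ.- i ∣ ⌋) (range k))

infix 4 _≈ᵖ_
_≈ᵖ_ : PS → PS → Set
f ≈ᵖ g = ∀ k → f k ≡ g k

zeroᵖ : PS
zeroᵖ _ = false

-- Over ℤ/2 the coefficient of x^k in a product of theta series counts, mod 2, the lattice points
-- of an ellipse lying in given residue classes, and squaring a series only doubles the exponents
-- (cross terms come in pairs).  Hence the coefficient of x^k in each of the four products counts
-- the solutions of N² + M² = k with (N, M) ≡ (2i, 2j) (mod l), weighted by [N even], [M even],
-- 1 and [N ≡ M (mod 2)] respectively: substitute N = 2x in [i]⁴[2j] (and symmetrically in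
-- [j]⁴[2i]) and (N, M) = (a + b, a − b) in [i+j]²[i−j]²; these substitutions can be inverted
-- because 2 is a unit modulo the odd number l.  The four weights always add up to an even number.
module Submission where

open import Defs

open import Algebra.Bundles using (CommutativeMonoid)
open import Data.Bool using (Bool; true; false; T; not; _xor_; _∧_)
open import Data.Bool.Properties
  using ( T-∧; xor-assoc; xor-identityʳ; ∧-commutativeMonoid; ∧-assoc; ∧-comm; ∧-idem; ∧-identityʳ
        ; ∧-zeroʳ; ∧-distribˡ-xor; ∧-distribʳ-xor)
open import Data.Bool.Solver using (module xor-∧-Solver)
open import Data.Integer as ℤ using (ℤ; +_; -[1+_]; ∣_∣; _⊖_)
import Data.Integer.Properties as ℤ
open import Data.Integer.Divisibility.Signed as Signed using (_∣_; divides)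
open import Data.Integer.DivMod using (_%ℕ_; _/ℕ_; n%ℕd<d; a≡a%ℕn+[a/ℕn]*n)
open import Data.Integer.Tactic.RingSolver using (solve-∀)
open import Data.List using (List; []; _∷_; _++_; map; length; filterᵇ; upTo; cartesianProduct)
open import Data.List.Properties using (length-map)
open import Data.List.Membership.Propositional using (_∈_)
open import Data.List.Membership.Propositional.Properties
  using (∈-map⁺; ∈-map⁻; ∈-filter⁺; ∈-filter⁻; ∈-upTo⁺; ∈-upTo⁻; ∈-cartesianProduct⁺)
open import Data.List.Membership.Propositional.Properties.WithK using (unique∧set⇒bag)
open import Data.List.Relation.Binary.BagAndSetEquality using (∼bag⇒↭)
open import Data.List.Relation.Binary.Permutation.Propositional.Properties using (↭-length)
open import Data.List.Relation.Unary.All using ([])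
open import Data.List.Relation.Unary.AllPairs using ([]; _∷_)
open import Data.List.Relation.Unary.Any using (here; there)
open import Data.List.Relation.Unary.Unique.Propositional using (Unique)
import Data.List.Relation.Unary.Unique.Propositional.Properties as Unique
open import Data.Nat as ℕ using (ℕ; zero; suc; _∸_; _≤_; _<_; _≡ᵇ_; z≤n; s≤s)
import Data.Nat.Properties as ℕ
open import Data.Nat.Divisibility using (_∣?_)
open import Data.Product using (_×_; _,_; proj₁; proj₂; ∃-syntax; swap)
open import Data.Product.Properties using (,-injective)
open import Data.Sum using (_⊎_; inj₁; inj₂)
open import Data.Unit using (tt)
open import Function using (id; _∘_; Equivalence; _⇔_; mk⇔; Injective)
open import Level using (Level)
open import Relation.Binary.PropositionalEquality
  using (_≡_; refl; sym; trans; cong; cong₂; subst; module ≡-Reasoning)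
open import Relation.Nullary.Decidable using (⌊_⌋; isYes≗does; toWitness; fromWitness; yes; no; T?)
open import Relation.Nullary.Negation using (contradiction)
open import Data.Nat using (ℕ; suc; _*_; _>_)
open import Data.Integer using (ℤ; _+_; _-_; +_)
open import Data.Integer using () renaming (_*_ to _*ℤ_)

open Equivalence using (to; from)
open import Algebra.Properties.CommutativeSemigroup ℕ.+-commutativeSemigroup
  using () renaming (x∙yz≈y∙xz to +-left-comm)
open import Algebra.Properties.CommutativeSemigroup (CommutativeMonoid.commutativeSemigroup ∧-commutativeMonoid)
  using () renaming (x∙yz≈y∙xz to ∧-left-comm)

private variable
  ℓ ℓ′ : Level
  A : Set ℓ
  B : Set ℓ′

⨁ : (A → Bool) → List A → Bool
⨁ h xs = ⊕-sum (map h xs)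

⨁-++ : (h : A → Bool) (xs ys : List A) → ⨁ h (xs ++ ys) ≡ ⨁ h xs xor ⨁ h ys
⨁-++ h []       ys = refl
⨁-++ h (x ∷ xs) ys = trans (cong (h x xor_) (⨁-++ h xs ys)) (sym (xor-assoc (h x) _ _))

⨁-cong : {h h′ : A → Bool} (xs : List A) → (∀ {x} → x ∈ xs → h x ≡ h′ x) → ⨁ h xs ≡ ⨁ h′ xs
⨁-cong []       eq = refl
⨁-cong (x ∷ xs) eq = cong₂ _xor_ (eq (here refl)) (⨁-cong xs (eq ∘ there))

⨁-false : (xs : List A) → ⨁ (λ _ → false) xs ≡ false
⨁-false []       = refl
⨁-false (x ∷ xs) = ⨁-false xs

⨁-xor : (h h′ : A → Bool) (xs : List A) → ⨁ (λ x → h x xor h′ x) xs ≡ ⨁ h xs xor ⨁ h′ xs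
⨁-xor h h′ []       = refl
⨁-xor h h′ (x ∷ xs) = begin
  (h x xor h′ x) xor ⨁ (λ x → h x xor h′ x) xs  ≡⟨ cong ((h x xor h′ x) xor_) (⨁-xor h h′ xs) ⟩
  (h x xor h′ x) xor (⨁ h xs xor ⨁ h′ xs)       ≡⟨ solve 4 (λ p q r s → (p :+ q) :+ (r :+ s) := (p :+ r) :+ (q :+ s))
                                                          refl (h x) (h′ x) (⨁ h xs) (⨁ h′ xs) ⟩
  (h x xor ⨁ h xs) xor (h′ x xor ⨁ h′ xs)       ∎
  where open ≡-Reasoning
        open xor-∧-Solver

∧-distribˡ-⨁ : (c : Bool) (h : A → Bool) (xs : List A) → c ∧ ⨁ h xs ≡ ⨁ (λ x → c ∧ h x) xs
∧-distribˡ-⨁ false h xs       = sym (⨁-false xs)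
∧-distribˡ-⨁ true  h xs       = refl

∧-distribʳ-⨁ : (c : Bool) (h : A → Bool) (xs : List A) → ⨁ h xs ∧ c ≡ ⨁ (λ x → h x ∧ c) xs
∧-distribʳ-⨁ c h []       = refl
∧-distribʳ-⨁ c h (x ∷ xs) = trans (∧-distribʳ-xor c (h x) (⨁ h xs)) (cong (h x ∧ c xor_) (∧-distribʳ-⨁ c h xs))

⨁-comm : (h : A → B → Bool) (xs : List A) (ys : List B) →
         ⨁ (λ x → ⨁ (h x) ys) xs ≡ ⨁ (λ y → ⨁ (λ x → h x y) xs) ys
⨁-comm h []       ys = sym (⨁-false ys)
⨁-comm h (x ∷ xs) ys = trans (cong (⨁ (h x) ys xor_) (⨁-comm h xs ys)) (sym (⨁-xor (h x) _ ys))

-- The xor-∧ solver normalises with coefficients in ℤ/2, so it cancels the two off-diagonal sums.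
⨁-diagonal : (h : A → A → Bool) → (∀ x y → h x y ≡ h y x) → (xs : List A) →
             ⨁ (λ x → ⨁ (h x) xs) xs ≡ ⨁ (λ x → h x x) xs
⨁-diagonal h sym-h []       = refl
⨁-diagonal h sym-h (x ∷ xs) = begin
  (h x x xor ⨁ (h x) xs) xor ⨁ (λ y → h y x xor ⨁ (h y) xs) xs
    ≡⟨ cong ((h x x xor ⨁ (h x) xs) xor_) (⨁-xor (λ y → h y x) (λ y → ⨁ (h y) xs) xs) ⟩
  (h x x xor ⨁ (h x) xs) xor (⨁ (λ y → h y x) xs xor ⨁ (λ y → ⨁ (h y) xs) xs)
    ≡⟨ cong₂ (λ u v → (h x x xor ⨁ (h x) xs) xor (u xor v))
             (⨁-cong xs (λ {y} _ → sym-h y x)) (⨁-diagonal h sym-h xs) ⟩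
  (h x x xor ⨁ (h x) xs) xor (⨁ (h x) xs xor ⨁ (λ y → h y y) xs)
    ≡⟨ solve 3 (λ p q r → (p :+ q) :+ (q :+ r) := p :+ r) refl (h x x) (⨁ (h x) xs) (⨁ (λ y → h y y) xs) ⟩
  h x x xor ⨁ (λ y → h y y) xs
    ∎
  where open ≡-Reasoning
        open xor-∧-Solver

⨁-cartesianProduct : (h : A × B → Bool) (xs : List A) (ys : List B) →
                     ⨁ h (cartesianProduct xs ys) ≡ ⨁ (λ x → ⨁ (λ y → h (x , y)) ys) xs
⨁-cartesianProduct h []       ys = refl
⨁-cartesianProduct h (x ∷ xs) ys =
  trans (⨁-++ h (map (x ,_) ys) (cartesianProduct xs ys))
        (cong₂ _xor_ (⨁-map ys) (⨁-cartesianProduct h xs ys))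
  where
  ⨁-map : ∀ zs → ⨁ h (map (x ,_) zs) ≡ ⨁ (λ y → h (x , y)) zs
  ⨁-map []       = refl
  ⨁-map (z ∷ zs) = cong (h (x , z) xor_) (⨁-map zs)

oddᵇ : ℕ → Bool
oddᵇ zero    = false
oddᵇ (suc n) = not (oddᵇ n)

⨁-oddᵇ-length : (p : A → Bool) (xs : List A) → ⨁ p xs ≡ oddᵇ (length (filterᵇ p xs))
⨁-oddᵇ-length p []       = refl
⨁-oddᵇ-length p (x ∷ xs) with p x
... | true  = cong not (⨁-oddᵇ-length p xs)
... | false = ⨁-oddᵇ-length p xs

⨁-bijection : (f : A → B) → Injective _≡_ _≡_ f → {p : A → Bool} {q : B → Bool}
              {xs : List A} {ys : List B} → Unique xs → Unique ys →
              (∀ {x} → x ∈ xs → T (p x) → f x ∈ ys × T (q (f x))) →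
              (∀ {y} → y ∈ ys → T (q y) → ∃[ x ] x ∈ xs × T (p x) × f x ≡ y) →
              ⨁ p xs ≡ ⨁ q ys
⨁-bijection f f-inj {p} {q} {xs} {ys} xs! ys! forth back = begin
  ⨁ p xs
    ≡⟨ ⨁-oddᵇ-length p xs ⟩
  oddᵇ (length (filterᵇ p xs))
    ≡⟨ cong oddᵇ (length-map f (filterᵇ p xs)) ⟨
  oddᵇ (length (map f (filterᵇ p xs)))
    ≡⟨ cong oddᵇ (↭-length (∼bag⇒↭ (unique∧set⇒bag image! qs! (mk⇔ image⊆filter filter⊆image)))) ⟩
  oddᵇ (length (filterᵇ q ys))
    ≡⟨ ⨁-oddᵇ-length q ys ⟨
  ⨁ q ys
    ∎
  where
  open ≡-Reasoning
  image! : Unique (map f (filterᵇ p xs))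
  image! = Unique.map⁺ f-inj (Unique.filter⁺ (T? ∘ p) xs!)
  qs! : Unique (filterᵇ q ys)
  qs! = Unique.filter⁺ (T? ∘ q) ys!
  image⊆filter : ∀ {y} → y ∈ map f (filterᵇ p xs) → y ∈ filterᵇ q ys
  image⊆filter y∈ with ∈-map⁻ f y∈
  ... | x , x∈ , refl with ∈-filter⁻ (T? ∘ p) x∈
  ... | x∈xs , px with forth x∈xs px
  ... | fx∈ys , qfx = ∈-filter⁺ (T? ∘ q) fx∈ys qfx
  filter⊆image : ∀ {y} → y ∈ filterᵇ q ys → y ∈ map f (filterᵇ p xs)
  filter⊆image y∈ with ∈-filter⁻ (T? ∘ q) y∈
  ... | y∈ys , qy with back y∈ys qy
  ... | x , x∈xs , px , refl = ∈-map⁺ f (∈-filter⁺ (T? ∘ p) x∈xs px)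

record Counts {a} {A : Set a} (K : ℕ) (f : PS) (xs : List A) (w : A → ℕ) (p : A → Bool) : Set a where
  constructor counts
  field coefficient : ∀ k → k ≤ K → f k ≡ ⨁ (λ x → (w x ≡ᵇ k) ∧ p x) xs

open Counts using (coefficient)

2*n≡n+n : ∀ n → 2 * n ≡ n ℕ.+ n
2*n≡n+n n = cong (n ℕ.+_) (ℕ.+-identityʳ n)

_⊞_ : (A → ℕ) → (B → ℕ) → A × B → ℕ
(w ⊞ v) z = w (proj₁ z) ℕ.+ v (proj₂ z)

_⊠_ : (A → Bool) → (B → Bool) → A × B → Bool
(p ⊠ q) z = p (proj₁ z) ∧ q (proj₂ z)

one-counts : ∀ K → Counts K one (tt ∷ []) (λ _ → 0) (λ _ → true)
one-counts K = counts λ where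
  zero    _ → refl
  (suc k) _ → refl

⨁-upTo-split : ∀ k c d → ⨁ (λ a → (c ≡ᵇ a) ∧ (d ≡ᵇ k ∸ a)) (upTo (suc k)) ≡ (c ℕ.+ d ≡ᵇ k)
⨁-upTo-split k c d =
  trans (⨁-bijection id id (Unique.upTo⁺ (suc k)) ([] ∷ []) forth back) (xor-identityʳ _)
  where
  forth : ∀ {a} → a ∈ upTo (suc k) → T ((c ≡ᵇ a) ∧ (d ≡ᵇ k ∸ a)) → a ∈ c ∷ [] × T (c ℕ.+ d ≡ᵇ k)
  forth {a} a∈ split with to T-∧ split
  ... | c≡a , d≡k∸a with ℕ.≡ᵇ⇒≡ c a c≡a | ℕ.≡ᵇ⇒≡ d (k ∸ a) d≡k∸a | ∈-upTo⁻ a∈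
  ... | refl | refl | s≤s c≤k = here refl , ℕ.≡⇒≡ᵇ (c ℕ.+ (k ∸ c)) k (ℕ.m+[n∸m]≡n c≤k)
  back : ∀ {a} → a ∈ c ∷ [] → T (c ℕ.+ d ≡ᵇ k) →
         ∃[ a′ ] a′ ∈ upTo (suc k) × T ((c ≡ᵇ a′) ∧ (d ≡ᵇ k ∸ a′)) × a′ ≡ a
  back (here refl) c+d≡k with ℕ.≡ᵇ⇒≡ (c ℕ.+ d) k c+d≡k
  ... | refl = c , ∈-upTo⁺ (s≤s (ℕ.m≤m+n c d))
             , from T-∧ (ℕ.≡⇒≡ᵇ c c refl , ℕ.≡⇒≡ᵇ d (c ℕ.+ d ∸ c) (sym (ℕ.m+n∸m≡n c d))) , refl

⊛-counts : ∀ {K f g} {xs : List A} {ys : List B} {w v p q} →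
           Counts K f xs w p → Counts K g ys v q →
           Counts K (f ⊛ g) (cartesianProduct xs ys) (w ⊞ v) (p ⊠ q)
⊛-counts {K = K} {f} {g} {xs} {ys} {w} {v} {p} {q} f-counts g-counts .coefficient k k≤K = begin
  ⨁ (λ a → f a ∧ g (k ∸ a)) ks
    ≡⟨ ⨁-cong ks (λ {a} a∈ks → cong₂ _∧_ (coefficient f-counts a (ℕ.≤-trans (a≤k a∈ks) k≤K))
                                         (coefficient g-counts (k ∸ a) (ℕ.≤-trans (ℕ.m∸n≤m k a) k≤K))) ⟩
  ⨁ (λ a → ⨁ (F a) xs ∧ ⨁ (G (k ∸ a)) ys) ks
    ≡⟨ ⨁-cong ks (λ {a} _ → trans (∧-distribʳ-⨁ _ (F a) xs)
                                  (⨁-cong xs (λ {x} _ → ∧-distribˡ-⨁ (F a x) (G (k ∸ a)) ys))) ⟩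
  ⨁ (λ a → ⨁ (λ x → ⨁ (λ y → F a x ∧ G (k ∸ a) y) ys) xs) ks
    ≡⟨ ⨁-comm _ ks xs ⟩
  ⨁ (λ x → ⨁ (λ a → ⨁ (λ y → F a x ∧ G (k ∸ a) y) ys) ks) xs
    ≡⟨ ⨁-cong xs (λ _ → ⨁-comm _ ks ys) ⟩
  ⨁ (λ x → ⨁ (λ y → ⨁ (λ a → F a x ∧ G (k ∸ a) y) ks) ys) xs
    ≡⟨ ⨁-cong xs (λ {x} _ → ⨁-cong ys (λ {y} _ → convolve x y)) ⟩
  ⨁ (λ x → ⨁ (λ y → ((w ⊞ v) (x , y) ≡ᵇ k) ∧ (p ⊠ q) (x , y)) ys) xs
    ≡⟨ sym (⨁-cartesianProduct _ xs ys) ⟩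
  ⨁ (λ z → ((w ⊞ v) z ≡ᵇ k) ∧ (p ⊠ q) z) (cartesianProduct xs ys)
    ∎
  where
  open ≡-Reasoning
  ks = upTo (suc k)
  F = λ a x → (w x ≡ᵇ a) ∧ p x
  G = λ a y → (v y ≡ᵇ a) ∧ q y
  a≤k : ∀ {a} → a ∈ ks → a ≤ k
  a≤k a∈ks with ∈-upTo⁻ a∈ks
  ... | s≤s a≤k = a≤k
  convolve : ∀ x y → ⨁ (λ a → F a x ∧ G (k ∸ a) y) ks ≡ ((w x ℕ.+ v y) ≡ᵇ k) ∧ (p x ∧ q y)
  convolve x y = begin
    ⨁ (λ a → F a x ∧ G (k ∸ a) y) ks
      ≡⟨ ⨁-cong ks (λ {a} _ → solve 4 (λ s t u r → (s :* u) :* (t :* r) := (s :* t) :* (u :* r))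
                                       refl (w x ≡ᵇ a) (v y ≡ᵇ k ∸ a) (p x) (q y)) ⟩
    ⨁ (λ a → ((w x ≡ᵇ a) ∧ (v y ≡ᵇ k ∸ a)) ∧ (p x ∧ q y)) ks
      ≡⟨ sym (∧-distribʳ-⨁ (p x ∧ q y) (λ a → (w x ≡ᵇ a) ∧ (v y ≡ᵇ k ∸ a)) ks) ⟩
    ⨁ (λ a → (w x ≡ᵇ a) ∧ (v y ≡ᵇ k ∸ a)) ks ∧ (p x ∧ q y)
      ≡⟨ cong (_∧ (p x ∧ q y)) (⨁-upTo-split k (w x) (v y)) ⟩
    ((w x ℕ.+ v y) ≡ᵇ k) ∧ (p x ∧ q y)
      ∎
    where open xor-∧-Solver

-- Freshman's dream: exchanging the two factors f is a symmetry of the triple sum, so only the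
-- terms in which both pick the same element survive.
⊛-square-counts : ∀ {K f g} {xs : List A} {ys : List B} {w v p q} →
                  Counts K f xs w p → Counts K g ys v q →
                  Counts K (f ⊛ (f ⊛ g)) (cartesianProduct xs ys) ((λ x → 2 * w x) ⊞ v) (p ⊠ q)
⊛-square-counts {K = K} {f} {g} {xs} {ys} {w} {v} {p} {q} f-counts g-counts .coefficient k k≤K = begin
  (f ⊛ (f ⊛ g)) k
    ≡⟨ coefficient (⊛-counts f-counts (⊛-counts f-counts g-counts)) k k≤K ⟩
  ⨁ H (cartesianProduct xs (cartesianProduct xs ys))
    ≡⟨ ⨁-cartesianProduct H xs _ ⟩
  ⨁ (λ x → ⨁ (λ yz → H (x , yz)) (cartesianProduct xs ys)) xs
    ≡⟨ ⨁-cong xs (λ {x} _ → ⨁-cartesianProduct (λ yz → H (x , yz)) xs ys) ⟩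
  ⨁ (λ x → ⨁ (λ y → ⨁ (h x y) ys) xs) xs
    ≡⟨ ⨁-diagonal (λ x y → ⨁ (h x y) ys) (λ x y → ⨁-cong ys (λ {z} _ → h-comm x y z)) xs ⟩
  ⨁ (λ x → ⨁ (h x x) ys) xs
    ≡⟨ ⨁-cong xs (λ {x} _ → ⨁-cong ys (λ {z} _ → h-diagonal x z)) ⟩
  ⨁ (λ x → ⨁ (λ z → ((2 * w x ℕ.+ v z) ≡ᵇ k) ∧ (p x ∧ q z)) ys) xs
    ≡⟨ sym (⨁-cartesianProduct _ xs ys) ⟩
  ⨁ (λ z → (((λ x → 2 * w x) ⊞ v) z ≡ᵇ k) ∧ (p ⊠ q) z) (cartesianProduct xs ys)
    ∎
  where
  open ≡-Reasoning
  H = λ z → ((w ⊞ (w ⊞ v)) z ≡ᵇ k) ∧ (p ⊠ (p ⊠ q)) z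
  h = λ x y z → ((w x ℕ.+ (w y ℕ.+ v z)) ≡ᵇ k) ∧ (p x ∧ (p y ∧ q z))
  h-comm : ∀ x y z → h x y z ≡ h y x z
  h-comm x y z = cong₂ (λ n c → (n ≡ᵇ k) ∧ c) (+-left-comm (w x) (w y) (v z)) (∧-left-comm (p x) (p y) (q z))
  h-diagonal : ∀ x z → h x x z ≡ ((2 * w x ℕ.+ v z) ≡ᵇ k) ∧ (p x ∧ q z)
  h-diagonal x z = cong₂ (λ n c → (n ≡ᵇ k) ∧ c)
    (trans (sym (ℕ.+-assoc (w x) (w x) (v z))) (cong (ℕ._+ v z) (sym (2*n≡n+n (w x)))))
    (trans (sym (∧-assoc (p x) (p x) (q z))) (cong (_∧ q z) (∧-idem (p x))))

diagonal-counts : ∀ {K f} {xs : List A} {u p} →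
                  Counts K f (cartesianProduct xs xs) (u ⊞ u) (p ⊠ p) →
                  Counts K f xs (λ x → 2 * u x) p
diagonal-counts {K = K} {f} {xs} {u} {p} f-counts .coefficient k k≤K = begin
  f k
    ≡⟨ coefficient f-counts k k≤K ⟩
  ⨁ (λ z → ((u ⊞ u) z ≡ᵇ k) ∧ (p ⊠ p) z) (cartesianProduct xs xs)
    ≡⟨ ⨁-cartesianProduct _ xs xs ⟩
  ⨁ (λ x → ⨁ (h x) xs) xs
    ≡⟨ ⨁-diagonal h h-comm xs ⟩
  ⨁ (λ x → h x x) xs
    ≡⟨ ⨁-cong xs (λ {x} _ → cong₂ (λ n c → (n ≡ᵇ k) ∧ c)
                                  (sym (2*n≡n+n (u x))) (∧-idem (p x))) ⟩
  ⨁ (λ x → ((2 * u x) ≡ᵇ k) ∧ p x) xs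
    ∎
  where
  open ≡-Reasoning
  h = λ x y → ((u x ℕ.+ u y) ≡ᵇ k) ∧ (p x ∧ p y)
  h-comm : ∀ x y → h x y ≡ h y x
  h-comm x y = cong₂ (λ n c → (n ≡ᵇ k) ∧ c) (ℕ.+-comm (u x) (u y)) (∧-comm (p x) (p y))

^ᵖ2-counts : ∀ {K f} {xs : List A} {w p} →
             Counts K f xs w p → Counts K (f ^ᵖ 2) xs (λ x → 2 * w x) p
^ᵖ2-counts {K = K} {f} {xs} {w} {p} f-counts .coefficient k k≤K =
  trans (coefficient (⊛-square-counts f-counts (one-counts K)) k k≤K)
        (trans (⨁-cartesianProduct _ xs (tt ∷ []))
               (⨁-cong xs (λ {x} _ → trans (xor-identityʳ _)
                                           (cong₂ (λ n c → (n ≡ᵇ k) ∧ c) (ℕ.+-identityʳ (2 * w x)) (∧-identityʳ (p x))))))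

^ᵖ4-counts : ∀ {K f} {xs : List A} {w p} →
             Counts K f xs w p → Counts K (f ^ᵖ 4) xs (λ x → 2 * (2 * w x)) p
^ᵖ4-counts {w = w} f-counts =
  diagonal-counts {u = λ x → 2 * w x} (⊛-square-counts f-counts (^ᵖ2-counts f-counts))

sq : ℤ → ℕ
sq n = ∣ n ℤ.* n ∣

+sq : ∀ n → + sq n ≡ n ℤ.* n
+sq (+ a)    = trans (cong (λ i → + ∣ i ∣) (sym (ℤ.pos-* a a))) (ℤ.pos-* a a)
+sq -[1+ a ] = refl

∣n∣≤sq : ∀ n → ∣ n ∣ ≤ sq n
∣n∣≤sq n with ∣ n ∣ | ℤ.abs-* n n
... | zero  | _  = z≤n
... | suc a | eq = ℕ.≤-trans (ℕ.m≤m*n (suc a) (suc a)) (ℕ.≤-reflexive (sym eq))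

∣m⊖n∣≡ᵇ0 : ∀ m n → (∣ m ⊖ n ∣ ≡ᵇ 0) ≡ (m ≡ᵇ n)
∣m⊖n∣≡ᵇ0 zero    zero    = refl
∣m⊖n∣≡ᵇ0 zero    (suc n) = refl
∣m⊖n∣≡ᵇ0 (suc m) zero    = refl
∣m⊖n∣≡ᵇ0 (suc m) (suc n) = trans (cong (λ i → ∣ i ∣ ≡ᵇ 0) (ℤ.[1+m]⊖[1+n]≡m⊖n m n)) (∣m⊖n∣≡ᵇ0 m n)

is-square-root : ∀ n k → ⌊ ∣ n ℤ.* n ℤ.- + k ∣ ℕ.≟ 0 ⌋ ≡ (sq n ≡ᵇ k)
is-square-root n k = begin
  ⌊ ∣ n ℤ.* n ℤ.- + k ∣ ℕ.≟ 0 ⌋ ≡⟨ isYes≗does (∣ n ℤ.* n ℤ.- + k ∣ ℕ.≟ 0) ⟩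
  (∣ n ℤ.* n ℤ.- + k ∣ ≡ᵇ 0) ≡⟨ cong (λ i → ∣ i ℤ.- + k ∣ ≡ᵇ 0) (sym (+sq n)) ⟩
  (∣ + sq n ℤ.- + k ∣ ≡ᵇ 0)  ≡⟨ cong (λ i → ∣ i ∣ ≡ᵇ 0) (ℤ.m-n≡m⊖n (sq n) k) ⟩
  (∣ sq n ⊖ k ∣ ≡ᵇ 0)        ≡⟨ ∣m⊖n∣≡ᵇ0 (sq n) k ⟩
  (sq n ≡ᵇ k)                ∎
  where open ≡-Reasoning

i-j+j≡i : ∀ i j → i ℤ.- j ℤ.+ j ≡ i
i-j+j≡i = solve-∀

i+j-j≡i : ∀ i j → i ℤ.+ j ℤ.- j ≡ i
i+j-j≡i = solve-∀

i-k≡j-k⇒i≡j : ∀ i j k → i ℤ.- k ≡ j ℤ.- k → i ≡ j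
i-k≡j-k⇒i≡j i j k eq = begin
  i                 ≡⟨ i-j+j≡i i k ⟨
  (i ℤ.- k) ℤ.+ k   ≡⟨ cong (ℤ._+ k) eq ⟩
  (j ℤ.- k) ℤ.+ k   ≡⟨ i-j+j≡i j k ⟩
  j                 ∎
  where open ≡-Reasoning

range-unique : ∀ K → Unique (range K)
range-unique K = Unique.map⁺ (λ eq → ℤ.+-injective (i-k≡j-k⇒i≡j _ _ (+ K) eq)) (Unique.upTo⁺ _)

∈-range⁻ : ∀ {K n} → n ∈ range K → ∣ n ∣ ≤ K
∈-range⁻ {K} n∈ with ∈-map⁻ _ n∈
... | a , a∈ , refl with ∈-upTo⁻ a∈ | ℕ.≤-total a K
... | _          | inj₁ a≤K = begin
  ∣ + a ℤ.- + K ∣ ≡⟨ cong ∣_∣ (ℤ.m-n≡m⊖n a K) ⟩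
  ∣ a ⊖ K ∣       ≡⟨ ℤ.∣⊖∣-≤ a≤K ⟩
  K ℕ.∸ a         ≤⟨ ℕ.m∸n≤m K a ⟩
  K               ∎
  where open ℕ.≤-Reasoning
... | s≤s a≤2K   | inj₂ K≤a = begin
  ∣ + a ℤ.- + K ∣ ≡⟨ cong ∣_∣ (ℤ.m-n≡m⊖n a K) ⟩
  ∣ a ⊖ K ∣       ≡⟨ ℤ.∣m⊖n∣≡∣n⊖m∣ a K ⟩
  ∣ K ⊖ a ∣       ≡⟨ ℤ.∣⊖∣-≤ K≤a ⟩
  a ℕ.∸ K         ≤⟨ ℕ.∸-monoˡ-≤ K a≤2K ⟩
  2 ℕ.* K ℕ.∸ K   ≡⟨ cong (ℕ._∸ K) (cong (K ℕ.+_) (ℕ.+-identityʳ K)) ⟩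
  K ℕ.+ K ℕ.∸ K   ≡⟨ ℕ.m+n∸m≡n K K ⟩
  K               ∎
  where open ℕ.≤-Reasoning

∈-range⁺ : ∀ {K n} → ∣ n ∣ ≤ K → n ∈ range K
∈-range⁺ {K} {+ b} b≤K = subst (_∈ range K) eq (∈-map⁺ _ (∈-upTo⁺ (s≤s b+K≤2K)))
  where
  b+K≤2K : b ℕ.+ K ≤ 2 ℕ.* K
  b+K≤2K = ℕ.≤-trans (ℕ.+-monoˡ-≤ K b≤K) (ℕ.≤-reflexive (cong (K ℕ.+_) (sym (ℕ.+-identityʳ K))))
  eq : + (b ℕ.+ K) ℤ.- + K ≡ + b
  eq = trans (cong (ℤ._- + K) (ℤ.pos-+ b K)) (i+j-j≡i (+ b) (+ K))
∈-range⁺ {K} { -[1+ b ]} 1+b≤K = subst (_∈ range K) eq (∈-map⁺ _ (∈-upTo⁺ (s≤s K∸1+b≤2K)))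
  where
  K∸1+b≤2K : K ℕ.∸ suc b ≤ 2 ℕ.* K
  K∸1+b≤2K = ℕ.≤-trans (ℕ.m∸n≤m K (suc b)) (ℕ.m≤m+n K _)
  eq : + (K ℕ.∸ suc b) ℤ.- + K ≡ -[1+ b ]
  eq = begin
    + (K ℕ.∸ suc b) ℤ.- + K       ≡⟨ cong (ℤ._- + K) (sym (ℤ.≤-⊖ 1+b≤K)) ⟩
    K ⊖ suc b ℤ.- + K             ≡⟨ cong (ℤ._- + K) (sym (ℤ.m-n≡m⊖n K (suc b))) ⟩
    + K ℤ.- + suc b ℤ.- + K       ≡⟨ k-j-k≡-j (+ K) (+ suc b) ⟩
    ℤ.- + suc b                   ∎
    where open ≡-Reasoning
          k-j-k≡-j : ∀ k j → k ℤ.- j ℤ.- k ≡ ℤ.- j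
          k-j-k≡-j = solve-∀

_∣ᵇ_ : ℕ → ℤ → Bool
l ∣ᵇ x = ⌊ l ∣? ∣ x ∣ ⌋

infix 4 _≡_mod_ _≡ᵇ_mod_

_≡_mod_ : ℤ → ℤ → ℕ → Set
_≡_mod_ x y l = + l ∣ x ℤ.- y

_≡ᵇ_mod_ : ℤ → ℤ → ℕ → Bool
_≡ᵇ_mod_ x y l = l ∣ᵇ (x ℤ.- y)

T-∣ᵇ : ∀ {l x} → T (l ∣ᵇ x) ⇔ + l ∣ x
T-∣ᵇ = mk⇔ (Signed.∣ᵤ⇒∣ ∘ toWitness) (fromWitness ∘ Signed.∣⇒∣ᵤ)

≡-mod-resp : ∀ {x x′ y y′ l} → x ≡ x′ → y ≡ y′ → x ≡ y mod l → x′ ≡ y′ mod l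
≡-mod-resp refl refl x≡y = x≡y

≡-mod-+ : ∀ {a b c d l} → a ≡ c mod l → b ≡ d mod l → a ℤ.+ b ≡ c ℤ.+ d mod l
≡-mod-+ {a} {b} {c} {d} a≡c b≡d =
  subst (_ ∣_) (regroup a b c d) (Signed.∣m∣n⇒∣m+n a≡c b≡d)
  where regroup : ∀ a b c d → (a ℤ.- c) ℤ.+ (b ℤ.- d) ≡ (a ℤ.+ b) ℤ.- (c ℤ.+ d)
        regroup = solve-∀

≡-mod-- : ∀ {a b c d l} → a ≡ c mod l → b ≡ d mod l → a ℤ.- b ≡ c ℤ.- d mod l
≡-mod-- {a} {b} {c} {d} a≡c b≡d =
  subst (_ ∣_) (regroup a b c d) (Signed.∣m∣n⇒∣m-n a≡c b≡d)
  where regroup : ∀ a b c d → (a ℤ.- c) ℤ.- (b ℤ.- d) ≡ (a ℤ.- b) ℤ.- (c ℤ.- d)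
        regroup = solve-∀

≡-mod-*ˡ : ∀ e {a c l} → a ≡ c mod l → e ℤ.* a ≡ e ℤ.* c mod l
≡-mod-*ˡ e {a} {c} a≡c = subst (_ ∣_) (distrib e a c) (Signed.∣n⇒∣m*n e a≡c)
  where distrib : ∀ e a c → e ℤ.* (a ℤ.- c) ≡ e ℤ.* a ℤ.- e ℤ.* c
        distrib = solve-∀

-- 2 is invertible modulo 2m + 1: a − c = (2m + 1)(a − c) − m (2a − 2c).
≡-mod-cancel-2* : ∀ m {a c} → + 2 ℤ.* a ≡ + 2 ℤ.* c mod suc (2 ℕ.* m) → a ≡ c mod suc (2 ℕ.* m)
≡-mod-cancel-2* m {a} {c} 2a≡2c = subst (_ ∣_) eq
  (Signed.∣m∣n⇒∣m-n (Signed.∣n⇒∣m*n (a ℤ.- c) (Signed.∣-refl {+ suc (2 ℕ.* m)}))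
                     (Signed.∣n⇒∣m*n (+ m) 2a≡2c))
  where
  l≡1+2m : + suc (2 ℕ.* m) ≡ + 1 ℤ.+ + 2 ℤ.* + m
  l≡1+2m = trans (ℤ.pos-+ 1 (2 ℕ.* m)) (cong (ℤ._+_ (+ 1)) (ℤ.pos-* 2 m))
  eq : (a ℤ.- c) ℤ.* + suc (2 ℕ.* m) ℤ.- + m ℤ.* (+ 2 ℤ.* a ℤ.- + 2 ℤ.* c) ≡ a ℤ.- c
  eq = trans (cong (λ l → (a ℤ.- c) ℤ.* l ℤ.- + m ℤ.* (+ 2 ℤ.* a ℤ.- + 2 ℤ.* c)) l≡1+2m) (cancel a c (+ m))
    where cancel : ∀ a c m → (a ℤ.- c) ℤ.* (+ 1 ℤ.+ + 2 ℤ.* m) ℤ.- m ℤ.* (+ 2 ℤ.* a ℤ.- + 2 ℤ.* c) ≡ a ℤ.- c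
          cancel = solve-∀

≡-mod⇒∣ᵇ-≡ : ∀ {x y l} → x ≡ y mod l → l ∣ᵇ x ≡ l ∣ᵇ y
≡-mod⇒∣ᵇ-≡ {x} {y} {l} x≡y with l ∣? ∣ x ∣ | l ∣? ∣ y ∣
... | yes _   | yes _    = refl
... | no  _   | no  _    = refl
... | yes l∣x | no  l∤y  = contradiction (Signed.∣⇒∣ᵤ (subst (_ ∣_) (x-[x-y]≡y x y)
                             (Signed.∣m∣n⇒∣m-n (Signed.∣ᵤ⇒∣ {i = x} l∣x) x≡y))) l∤y
  where x-[x-y]≡y : ∀ x y → x ℤ.- (x ℤ.- y) ≡ y
        x-[x-y]≡y = solve-∀
... | no  l∤x | yes l∣y  = contradiction (Signed.∣⇒∣ᵤ (subst (_ ∣_) (i-j+j≡i x y)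
                             (Signed.∣m∣n⇒∣m+n x≡y (Signed.∣ᵤ⇒∣ {i = y} l∣y)))) l∤x

even : ℤ → Bool
even x = 2 ∣ᵇ x

mod-2-cases : ∀ x → x ≡ + 0 mod 2 ⊎ x ≡ + 1 mod 2
mod-2-cases x = by-remainder (x %ℕ 2) (n%ℕd<d x 2) (a≡a%ℕn+[a/ℕn]*n x 2)
  where
  r+q-r≡q : ∀ r q → r ℤ.+ q ℤ.- r ≡ q
  r+q-r≡q = solve-∀
  by-remainder : ∀ r → r < 2 → x ≡ + r ℤ.+ (x /ℕ 2) ℤ.* + 2 → x ≡ + 0 mod 2 ⊎ x ≡ + 1 mod 2
  by-remainder 0 _ x≡r+2q = inj₁ (divides (x /ℕ 2) (trans (cong (ℤ._- + 0) x≡r+2q) (r+q-r≡q (+ 0) _)))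
  by-remainder 1 _ x≡r+2q = inj₂ (divides (x /ℕ 2) (trans (cong (ℤ._- + 1) x≡r+2q) (r+q-r≡q (+ 1) _)))
  by-remainder (suc (suc _)) (s≤s (s≤s ())) _

same-parity : ∀ x y → (x ≡ᵇ y mod 2) ≡ not (even x xor even y)
same-parity x y = by-cases (mod-2-cases x) (mod-2-cases y)
  where
  reduce : ∀ {r s} → x ≡ r mod 2 → y ≡ s mod 2 →
           (r ≡ᵇ s mod 2) ≡ not (even r xor even s) → (x ≡ᵇ y mod 2) ≡ not (even x xor even y)
  reduce {r} {s} x≡r y≡s eq = begin
    (x ≡ᵇ y mod 2)             ≡⟨ ≡-mod⇒∣ᵇ-≡ {x ℤ.- y} {r ℤ.- s} (≡-mod-- {x} {y} {r} {s} x≡r y≡s) ⟩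
    (r ≡ᵇ s mod 2)             ≡⟨ eq ⟩
    not (even r xor even s)    ≡⟨ cong₂ (λ a b → not (a xor b)) (≡-mod⇒∣ᵇ-≡ {x} {r} x≡r) (≡-mod⇒∣ᵇ-≡ {y} {s} y≡s) ⟨
    not (even x xor even y)    ∎
    where open ≡-Reasoning
  by-cases : x ≡ + 0 mod 2 ⊎ x ≡ + 1 mod 2 → y ≡ + 0 mod 2 ⊎ y ≡ + 1 mod 2 →
             (x ≡ᵇ y mod 2) ≡ not (even x xor even y)
  by-cases (inj₁ x≡0) (inj₁ y≡0) = reduce {+ 0} {+ 0} x≡0 y≡0 refl
  by-cases (inj₁ x≡0) (inj₂ y≡1) = reduce {+ 0} {+ 1} x≡0 y≡1 refl
  by-cases (inj₂ x≡1) (inj₁ y≡0) = reduce {+ 1} {+ 0} x≡1 y≡0 refl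
  by-cases (inj₂ x≡1) (inj₂ y≡1) = reduce {+ 1} {+ 1} x≡1 y≡1 refl

theta-counts : ∀ l c K → Counts K (theta l c) (range K) sq (λ n → n ≡ᵇ c mod l)
theta-counts l c K .coefficient k k≤K =
  trans (⨁-cong (range k) (λ {n} _ → cong (_∧ (n ≡ᵇ c mod l)) (is-square-root n k)))
        (⨁-bijection id id (range-unique k) (range-unique K) forth back)
  where
  solution = λ n → (sq n ≡ᵇ k) ∧ (n ≡ᵇ c mod l)
  forth : ∀ {n} → n ∈ range k → T (solution n) → n ∈ range K × T (solution n)
  forth n∈ sol = ∈-range⁺ (ℕ.≤-trans (∈-range⁻ n∈) k≤K) , sol
  back : ∀ {n} → n ∈ range K → T (solution n) → ∃[ n′ ] n′ ∈ range k × T (solution n′) × n′ ≡ n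
  back {n} _ sol with ℕ.≡ᵇ⇒≡ (sq n) k (proj₁ (to T-∧ sol))
  ... | refl = n , ∈-range⁺ (∣n∣≤sq n) , sol , refl

sq-2* : ∀ x → sq (+ 2 ℤ.* x) ≡ 2 ℕ.* (2 ℕ.* sq x)
sq-2* x = ℤ.+-injective (begin
  + sq (+ 2 ℤ.* x)                  ≡⟨ +sq (+ 2 ℤ.* x) ⟩
  (+ 2 ℤ.* x) ℤ.* (+ 2 ℤ.* x)       ≡⟨ expand x ⟩
  + 2 ℤ.* (+ 2 ℤ.* (x ℤ.* x))       ≡⟨ cong (λ i → + 2 ℤ.* (+ 2 ℤ.* i)) (sym (+sq x)) ⟩
  + 2 ℤ.* (+ 2 ℤ.* + sq x)          ≡⟨ cong (+ 2 ℤ.*_) (ℤ.pos-* 2 (sq x)) ⟨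
  + 2 ℤ.* + (2 ℕ.* sq x)            ≡⟨ ℤ.pos-* 2 (2 ℕ.* sq x) ⟨
  + (2 ℕ.* (2 ℕ.* sq x))            ∎)
  where
  open ≡-Reasoning
  expand : ∀ x → (+ 2 ℤ.* x) ℤ.* (+ 2 ℤ.* x) ≡ + 2 ℤ.* (+ 2 ℤ.* (x ℤ.* x))
  expand = solve-∀

sq-+-sq-- : ∀ a b → sq (a ℤ.+ b) ℕ.+ sq (a ℤ.- b) ≡ 2 ℕ.* sq a ℕ.+ 2 ℕ.* sq b
sq-+-sq-- a b = ℤ.+-injective (begin
  + (sq (a ℤ.+ b) ℕ.+ sq (a ℤ.- b))               ≡⟨ ℤ.pos-+ (sq (a ℤ.+ b)) _ ⟩
  + sq (a ℤ.+ b) ℤ.+ + sq (a ℤ.- b)               ≡⟨ cong₂ ℤ._+_ (+sq (a ℤ.+ b)) (+sq (a ℤ.- b)) ⟩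
  (a ℤ.+ b) ℤ.* (a ℤ.+ b) ℤ.+ (a ℤ.- b) ℤ.* (a ℤ.- b) ≡⟨ parallelogram a b ⟩
  + 2 ℤ.* (a ℤ.* a) ℤ.+ + 2 ℤ.* (b ℤ.* b)           ≡⟨ cong₂ (λ i j → + 2 ℤ.* i ℤ.+ + 2 ℤ.* j) (+sq a) (+sq b) ⟨
  + 2 ℤ.* + sq a ℤ.+ + 2 ℤ.* + sq b               ≡⟨ cong₂ ℤ._+_ (ℤ.pos-* 2 (sq a)) (ℤ.pos-* 2 (sq b)) ⟨
  + (2 ℕ.* sq a) ℤ.+ + (2 ℕ.* sq b)               ≡⟨ ℤ.pos-+ (2 ℕ.* sq a) _ ⟨
  + (2 ℕ.* sq a ℕ.+ 2 ℕ.* sq b)                   ∎)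
  where
  open ≡-Reasoning
  parallelogram : ∀ a b → (a ℤ.+ b) ℤ.* (a ℤ.+ b) ℤ.+ (a ℤ.- b) ℤ.* (a ℤ.- b) ≡
                          + 2 ℤ.* (a ℤ.* a) ℤ.+ + 2 ℤ.* (b ℤ.* b)
  parallelogram = solve-∀

[a+b]+[a-b]≡2a : ∀ a b → (a ℤ.+ b) ℤ.+ (a ℤ.- b) ≡ + 2 ℤ.* a
[a+b]+[a-b]≡2a = solve-∀

[a+b]-[a-b]≡2b : ∀ a b → (a ℤ.+ b) ℤ.- (a ℤ.- b) ≡ + 2 ℤ.* b
[a+b]-[a-b]≡2b = solve-∀

double-sum-difference : ∀ {a b i j l} → a ≡ i ℤ.+ j mod l → b ≡ i ℤ.- j mod l →
                        a ℤ.+ b ≡ + 2 ℤ.* i mod l × a ℤ.- b ≡ + 2 ℤ.* j mod l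
double-sum-difference {a} {b} {i} {j} {l} a≡i+j b≡i-j =
  ≡-mod-resp {a ℤ.+ b} {l = l} refl ([a+b]+[a-b]≡2a i j) (≡-mod-+ {a} {b} {i ℤ.+ j} {i ℤ.- j} {l} a≡i+j b≡i-j) ,
  ≡-mod-resp {a ℤ.- b} {l = l} refl ([a+b]-[a-b]≡2b i j) (≡-mod-- {a} {b} {i ℤ.+ j} {i ℤ.- j} {l} a≡i+j b≡i-j)

halve-sum-difference : ∀ m {a b i j} → let l = suc (2 ℕ.* m) in
  a ℤ.+ b ≡ + 2 ℤ.* i mod l → a ℤ.- b ≡ + 2 ℤ.* j mod l → a ≡ i ℤ.+ j mod l × b ≡ i ℤ.- j mod l
halve-sum-difference m {a} {b} {i} {j} a+b≡2i a-b≡2j =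
  ≡-mod-cancel-2* m {a} {i ℤ.+ j} (≡-mod-resp ([a+b]+[a-b]≡2a a b) (sym (ℤ.*-distribˡ-+ (+ 2) i j))
    (≡-mod-+ {a ℤ.+ b} {a ℤ.- b} {+ 2 ℤ.* i} {+ 2 ℤ.* j} a+b≡2i a-b≡2j)) ,
  ≡-mod-cancel-2* m {b} {i ℤ.- j} (≡-mod-resp ([a+b]-[a-b]≡2b a b) (2i-2j≡2[i-j] i j)
    (≡-mod-- {a ℤ.+ b} {a ℤ.- b} {+ 2 ℤ.* i} {+ 2 ℤ.* j} a+b≡2i a-b≡2j))
  where 2i-2j≡2[i-j] : ∀ i j → + 2 ℤ.* i ℤ.- + 2 ℤ.* j ≡ + 2 ℤ.* (i ℤ.- j)
        2i-2j≡2[i-j] = solve-∀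

sum-difference-of-same-parity : ∀ N M d → N ℤ.- M ≡ d ℤ.* + 2 →
                                (M ℤ.+ d) ℤ.+ d ≡ N × (M ℤ.+ d) ℤ.- d ≡ M
sum-difference-of-same-parity N M d N-M≡2d =
  trans (regroup M d) (trans (cong (ℤ._+ M) (sym N-M≡2d)) (i-j+j≡i N M)) , i+j-j≡i M d
  where regroup : ∀ M d → M ℤ.+ d ℤ.+ d ≡ d ℤ.* + 2 ℤ.+ M
        regroup = solve-∀

pairs : ℕ → List (ℤ × ℤ)
pairs k = cartesianProduct (range k) (range k)

-- Only the pairs in range k are inspected; no solution of ω z = k is missed as long as ω
-- dominates the squares of both coordinates (see ∈-pairs).
count : ℕ → (ℤ × ℤ → ℕ) → (ℤ × ℤ → Bool) → Bool
count k ω φ = ⨁ (λ z → (ω z ≡ᵇ k) ∧ φ z) (pairs k)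

DominatesSquares : (ℤ → ℕ) → Set
DominatesSquares u = ∀ x → sq x ≤ u x

∈-pairs : ∀ {u v k z} → DominatesSquares u → DominatesSquares v → (u ⊞ v) z ≡ k → z ∈ pairs k
∈-pairs {u} {v} {k} {x , y} u≥sq v≥sq refl =
  ∈-cartesianProduct⁺ (∈-range⁺ (ℕ.≤-trans (∣n∣≤sq x) (ℕ.≤-trans (u≥sq x) (ℕ.m≤m+n (u x) (v y)))))
                      (∈-range⁺ (ℕ.≤-trans (∣n∣≤sq y) (ℕ.≤-trans (v≥sq y) (ℕ.m≤n+m (v y) (u x)))))

count-transfer : ∀ {k u v u′ v′ φ ψ} (f : ℤ × ℤ → ℤ × ℤ) → Injective _≡_ _≡_ f →
  DominatesSquares u → DominatesSquares v → DominatesSquares u′ → DominatesSquares v′ →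
  (∀ z → (u ⊞ v) z ≡ k → T (φ z) → (u′ ⊞ v′) (f z) ≡ k × T (ψ (f z))) →
  (∀ z → (u′ ⊞ v′) z ≡ k → T (ψ z) → ∃[ z₀ ] (u ⊞ v) z₀ ≡ k × T (φ z₀) × f z₀ ≡ z) →
  count k (u ⊞ v) φ ≡ count k (u′ ⊞ v′) ψ
count-transfer {k} {u} {v} {u′} {v′} {φ} {ψ} f f-inj u≥ v≥ u′≥ v′≥ forth back =
  ⨁-bijection f f-inj pairs-unique pairs-unique forth′ back′
  where
  pairs-unique = Unique.cartesianProduct⁺ (range-unique k) (range-unique k)
  forth′ : ∀ {z} → z ∈ pairs k → T (((u ⊞ v) z ≡ᵇ k) ∧ φ z) →
           f z ∈ pairs k × T (((u′ ⊞ v′) (f z) ≡ᵇ k) ∧ ψ (f z))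
  forth′ {z} _ sol with to T-∧ sol
  ... | ω≡k , φz with forth z (ℕ.≡ᵇ⇒≡ _ k ω≡k) φz
  ... | ω′≡k , ψfz = ∈-pairs u′≥ v′≥ ω′≡k , from T-∧ (ℕ.≡⇒≡ᵇ _ k ω′≡k , ψfz)
  back′ : ∀ {z} → z ∈ pairs k → T (((u′ ⊞ v′) z ≡ᵇ k) ∧ ψ z) →
          ∃[ z₀ ] z₀ ∈ pairs k × T (((u ⊞ v) z₀ ≡ᵇ k) ∧ φ z₀) × f z₀ ≡ z
  back′ {z} _ sol with to T-∧ sol
  ... | ω′≡k , ψz with back z (ℕ.≡ᵇ⇒≡ _ k ω′≡k) ψz
  ... | z₀ , ω≡k , φz₀ , fz₀≡z = z₀ , ∈-pairs u≥ v≥ ω≡k , from T-∧ (ℕ.≡⇒≡ᵇ _ k ω≡k , φz₀) , fz₀≡z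

infix 7 _≡²_mod_

_≡²_mod_ : ℤ × ℤ → ℤ × ℤ → ℕ → Bool
z ≡² c mod l = (proj₁ z ≡ᵇ proj₁ c mod l) ∧ (proj₂ z ≡ᵇ proj₂ c mod l)

sq≥sq : DominatesSquares sq
sq≥sq x = ℕ.≤-refl

2*-dominates : ∀ {u} → DominatesSquares u → DominatesSquares (λ x → 2 ℕ.* u x)
2*-dominates u≥sq x = ℕ.≤-trans (u≥sq x) (ℕ.m≤n*m _ 2)

-- (N, M) = (2x, y); recovering x ≡ c from 2x ≡ 2c needs l odd.
count-double : ∀ m k c d → let l = suc (2 ℕ.* m) in
  count k ((λ x → 2 ℕ.* (2 ℕ.* sq x)) ⊞ sq) (λ z → z ≡² (c , d) mod l) ≡
  count k (sq ⊞ sq) (λ z → even (proj₁ z) ∧ z ≡² (+ 2 ℤ.* c , d) mod l)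
count-double m k c d = count-transfer double double-injective
  (2*-dominates (2*-dominates sq≥sq)) sq≥sq sq≥sq sq≥sq forth back
  where
  l = suc (2 ℕ.* m)
  double : ℤ × ℤ → ℤ × ℤ
  double (x , y) = (+ 2 ℤ.* x , y)
  double-injective : Injective _≡_ _≡_ double
  double-injective {x , y} {x′ , y′} eq with ,-injective eq
  ... | 2x≡2x′ , refl = cong (_, y) (ℤ.*-cancelˡ-≡ (+ 2) x x′ 2x≡2x′)
  forth : ∀ z → 2 ℕ.* (2 ℕ.* sq (proj₁ z)) ℕ.+ sq (proj₂ z) ≡ k → T (z ≡² (c , d) mod l) →
          sq (+ 2 ℤ.* proj₁ z) ℕ.+ sq (proj₂ z) ≡ k ×
          T (even (+ 2 ℤ.* proj₁ z) ∧ double z ≡² (+ 2 ℤ.* c , d) mod l)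
  forth (x , y) weight≡k sol with to T-∧ sol
  ... | x≡c , y≡d =
    trans (cong (ℕ._+ sq y) (sq-2* x)) weight≡k ,
    from T-∧ (from T-∣ᵇ (divides x (ℤ.*-comm (+ 2) x)) ,
              from T-∧ (from T-∣ᵇ (≡-mod-*ˡ (+ 2) {x} {c} {l} (to T-∣ᵇ x≡c)) , y≡d))
  back : ∀ z → sq (proj₁ z) ℕ.+ sq (proj₂ z) ≡ k → T (even (proj₁ z) ∧ z ≡² (+ 2 ℤ.* c , d) mod l) →
         ∃[ z₀ ] 2 ℕ.* (2 ℕ.* sq (proj₁ z₀)) ℕ.+ sq (proj₂ z₀) ≡ k × T (z₀ ≡² (c , d) mod l) ×
                 double z₀ ≡ z
  back (N , M) weight≡k sol with to T-∧ sol
  ... | N-even , sol′ with to T-∧ sol′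
  ... | N≡2c , M≡d with to (T-∣ᵇ {2} {N}) N-even
  ... | divides x refl =
    (x , M) ,
    trans (cong (ℕ._+ sq M) (trans (sym (sq-2* x)) (cong sq 2x≡x*2))) weight≡k ,
    from T-∧ (from T-∣ᵇ (≡-mod-cancel-2* m {x} {c} (≡-mod-resp {l = l} (sym 2x≡x*2) refl (to T-∣ᵇ N≡2c))) , M≡d) ,
    cong (_, M) 2x≡x*2
    where 2x≡x*2 = ℤ.*-comm (+ 2) x

count-swap : ∀ k φ → count k (sq ⊞ sq) (λ z → φ (swap z)) ≡ count k (sq ⊞ sq) φ
count-swap k φ = count-transfer {k = k} {φ = λ z → φ (swap z)} {ψ = φ} swap (cong swap) sq≥sq sq≥sq sq≥sq sq≥sq
  (λ (x , y) weight≡k sol → trans (ℕ.+-comm (sq y) (sq x)) weight≡k , sol)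
  (λ (x , y) weight≡k sol → (y , x) , trans (ℕ.+-comm (sq y) (sq x)) weight≡k , sol , refl)

-- (N, M) = (a + b, a − b), with inverse (a, b) = (M + d, d) where N − M = 2d.
count-sum-difference : ∀ m k i j → let l = suc (2 ℕ.* m) in
  count k ((λ x → 2 ℕ.* sq x) ⊞ (λ y → 2 ℕ.* sq y)) (λ z → z ≡² (i ℤ.+ j , i ℤ.- j) mod l) ≡
  count k (sq ⊞ sq) (λ z → (proj₁ z ≡ᵇ proj₂ z mod 2) ∧ z ≡² (+ 2 ℤ.* i , + 2 ℤ.* j) mod l)
count-sum-difference m k i j = count-transfer sum-difference sum-difference-injective
  (2*-dominates sq≥sq) (2*-dominates sq≥sq) sq≥sq sq≥sq forth back
  where
  l = suc (2 ℕ.* m)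
  sum-difference : ℤ × ℤ → ℤ × ℤ
  sum-difference (a , b) = (a ℤ.+ b , a ℤ.- b)
  sum-difference-injective : Injective _≡_ _≡_ sum-difference
  sum-difference-injective {a , b} {a′ , b′} eq with ,-injective eq
  ... | s≡s′ , d≡d′ = cong₂ _,_
    (ℤ.*-cancelˡ-≡ (+ 2) a a′ (trans (sym ([a+b]+[a-b]≡2a a b))
                                     (trans (cong₂ ℤ._+_ s≡s′ d≡d′) ([a+b]+[a-b]≡2a a′ b′))))
    (ℤ.*-cancelˡ-≡ (+ 2) b b′ (trans (sym ([a+b]-[a-b]≡2b a b))
                                     (trans (cong₂ ℤ._-_ s≡s′ d≡d′) ([a+b]-[a-b]≡2b a′ b′))))
  forth : ∀ z → 2 ℕ.* sq (proj₁ z) ℕ.+ 2 ℕ.* sq (proj₂ z) ≡ k → T (z ≡² (i ℤ.+ j , i ℤ.- j) mod l) →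
          (sq ⊞ sq) (sum-difference z) ≡ k ×
          T ((proj₁ (sum-difference z) ≡ᵇ proj₂ (sum-difference z) mod 2) ∧
             sum-difference z ≡² (+ 2 ℤ.* i , + 2 ℤ.* j) mod l)
  forth (a , b) weight≡k sol with to T-∧ sol
  ... | a≡i+j , b≡i-j with double-sum-difference {a} {b} {i} {j} {l} (to T-∣ᵇ a≡i+j) (to T-∣ᵇ b≡i-j)
  ... | a+b≡2i , a-b≡2j =
    trans (sq-+-sq-- a b) weight≡k ,
    from T-∧ (from T-∣ᵇ (divides b (trans ([a+b]-[a-b]≡2b a b) (ℤ.*-comm (+ 2) b))) ,
              from T-∧ (from T-∣ᵇ a+b≡2i , from T-∣ᵇ a-b≡2j))
  back : ∀ z → sq (proj₁ z) ℕ.+ sq (proj₂ z) ≡ k →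
         T ((proj₁ z ≡ᵇ proj₂ z mod 2) ∧ z ≡² (+ 2 ℤ.* i , + 2 ℤ.* j) mod l) →
         ∃[ z₀ ] 2 ℕ.* sq (proj₁ z₀) ℕ.+ 2 ℕ.* sq (proj₂ z₀) ≡ k × T (z₀ ≡² (i ℤ.+ j , i ℤ.- j) mod l) ×
                 sum-difference z₀ ≡ z
  back (N , M) weight≡k sol with to T-∧ sol
  ... | N≡M , sol′ with to T-∧ sol′ | to (T-∣ᵇ {2} {N ℤ.- M}) N≡M
  ... | N≡2i , M≡2j | divides d N-M≡d*2 =
    (a , b) ,
    trans (sym (sq-+-sq-- a b)) (trans (cong₂ (λ s t → sq s ℕ.+ sq t) a+b≡N a-b≡M) weight≡k) ,
    from T-∧ (from T-∣ᵇ (proj₁ halves) , from T-∣ᵇ (proj₂ halves)) ,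
    cong₂ _,_ a+b≡N a-b≡M
    where
    a = M ℤ.+ d
    b = d
    a+b≡N = proj₁ (sum-difference-of-same-parity N M d N-M≡d*2)
    a-b≡M = proj₂ (sum-difference-of-same-parity N M d N-M≡d*2)
    halves : a ≡ i ℤ.+ j mod l × b ≡ i ℤ.- j mod l
    halves = halve-sum-difference m {a} {b} {i} {j}
      (≡-mod-resp {N} {a ℤ.+ b} {+ 2 ℤ.* i} {+ 2 ℤ.* i} {l} (sym a+b≡N) refl (to T-∣ᵇ N≡2i))
      (≡-mod-resp {M} {a ℤ.- b} {+ 2 ℤ.* j} {+ 2 ℤ.* j} {l} (sym a-b≡M) refl (to T-∣ᵇ M≡2j))

count-xor : ∀ k ω φ ψ → count k ω φ xor count k ω ψ ≡ count k ω (λ z → φ z xor ψ z)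
count-xor k ω φ ψ = sym (trans (⨁-cong (pairs k) (λ {z} _ → ∧-distribˡ-xor (ω z ≡ᵇ k) (φ z) (ψ z)))
                               (⨁-xor (λ z → (ω z ≡ᵇ k) ∧ φ z) (λ z → (ω z ≡ᵇ k) ∧ ψ z) (pairs k)))

count-false : ∀ k ω φ → (∀ z → φ z ≡ false) → count k ω φ ≡ false
count-false k ω φ φ≡false =
  trans (⨁-cong (pairs k) (λ {z} _ → trans (cong ((ω z ≡ᵇ k) ∧_) (φ≡false z)) (∧-zeroʳ _)))
        (⨁-false (pairs k))

module _ (m k : ℕ) (i j : ℤ) where
  private
    l = suc (2 * m)
    [_] = theta l
    θ = λ c → theta-counts l c k

  coefficient-[i]⁴[2j] : (([ i ] ^ᵖ 4) ⊛ [ + 2 *ℤ j ]) k ≡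
                         count k (sq ⊞ sq) (λ z → even (proj₁ z) ∧ z ≡² (+ 2 *ℤ i , + 2 *ℤ j) mod l)
  coefficient-[i]⁴[2j] = trans (coefficient (⊛-counts (^ᵖ4-counts (θ i)) (θ (+ 2 *ℤ j))) k ℕ.≤-refl)
                                (count-double m k i (+ 2 *ℤ j))

  coefficient-[j]⁴[2i] : (([ j ] ^ᵖ 4) ⊛ [ + 2 *ℤ i ]) k ≡
                         count k (sq ⊞ sq) (λ z → even (proj₂ z) ∧ swap z ≡² (+ 2 *ℤ j , + 2 *ℤ i) mod l)
  coefficient-[j]⁴[2i] = trans (coefficient (⊛-counts (^ᵖ4-counts (θ j)) (θ (+ 2 *ℤ i))) k ℕ.≤-refl)
                                (trans (count-double m k j (+ 2 *ℤ i))
                                       (sym (count-swap k (λ z → even (proj₁ z) ∧ z ≡² (+ 2 *ℤ j , + 2 *ℤ i) mod l))))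

  coefficient-[2i][2j] : ([ + 2 *ℤ i ] ⊛ [ + 2 *ℤ j ]) k ≡
                         count k (sq ⊞ sq) (λ z → z ≡² (+ 2 *ℤ i , + 2 *ℤ j) mod l)
  coefficient-[2i][2j] = coefficient (⊛-counts (θ (+ 2 *ℤ i)) (θ (+ 2 *ℤ j))) k ℕ.≤-refl

  coefficient-[i+j]²[i-j]² : (([ i + j ] ^ᵖ 2) ⊛ ([ i - j ] ^ᵖ 2)) k ≡
                             count k (sq ⊞ sq) (λ z → (proj₁ z ≡ᵇ proj₂ z mod 2) ∧ z ≡² (+ 2 *ℤ i , + 2 *ℤ j) mod l)
  coefficient-[i+j]²[i-j]² =
    trans (coefficient (⊛-counts (^ᵖ2-counts (θ (i + j))) (^ᵖ2-counts (θ (i - j)))) k ℕ.≤-refl)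
          (count-sum-difference m k i j)

-- A solution (N, M) is counted [N even] + [M even] + 1 + [N ≡ M (mod 2)] times, always an even number.
parity-cancellation : ∀ N M a b →
  ((even N ∧ (a ∧ b) xor even M ∧ (b ∧ a)) xor (a ∧ b)) xor (N ≡ᵇ M mod 2) ∧ (a ∧ b) ≡ false
parity-cancellation N M a b = begin
  ((even N ∧ (a ∧ b) xor even M ∧ (b ∧ a)) xor (a ∧ b)) xor (N ≡ᵇ M mod 2) ∧ (a ∧ b)
    ≡⟨ cong (λ p → ((even N ∧ (a ∧ b) xor even M ∧ (b ∧ a)) xor (a ∧ b)) xor p ∧ (a ∧ b)) (same-parity N M) ⟩
  ((even N ∧ (a ∧ b) xor even M ∧ (b ∧ a)) xor (a ∧ b)) xor (true xor (even N xor even M)) ∧ (a ∧ b)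
    ≡⟨ solve 4 (λ x y a b → ((x :* (a :* b) :+ y :* (b :* a)) :+ a :* b) :+ (con true :+ (x :+ y)) :* (a :* b) := con false)
               refl (even N) (even M) a b ⟩
  false
    ∎
  where open ≡-Reasoning
        open xor-∧-Solver using (solve; _:=_; _:+_; _:*_; con)

theorem3p6 : (m : ℕ) → m > 0 → (i j : ℤ) →
    let l = suc (2 * m) in
    let [_] = theta l in
    ([ i ] ^ᵖ 4) ⊛ [ (+ 2) *ℤ j ] ⊕ ([ j ] ^ᵖ 4) ⊛ [ (+ 2) *ℤ i ] ⊕ [ (+ 2) *ℤ i ] ⊛ [ (+ 2) *ℤ j ] ⊕ ([ i + j ] ^ᵖ 2) ⊛ ([ i - j ] ^ᵖ 2) ≈ᵖ zeroᵖ
theorem3p6 m _ i j k = begin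
  ((T₁ xor T₂) xor T₃) xor T₄
    ≡⟨ cong₂ _xor_ (cong₂ _xor_ (cong₂ _xor_ (coefficient-[i]⁴[2j] m k i j) (coefficient-[j]⁴[2i] m k i j))
                                (coefficient-[2i][2j] m k i j))
                   (coefficient-[i+j]²[i-j]² m k i j) ⟩
  ((count k ω φ₁ xor count k ω φ₂) xor count k ω φ₃) xor count k ω φ₄
    ≡⟨ cong (λ c → (c xor count k ω φ₃) xor count k ω φ₄) (count-xor k ω φ₁ φ₂) ⟩
  (count k ω (λ z → φ₁ z xor φ₂ z) xor count k ω φ₃) xor count k ω φ₄
    ≡⟨ cong (_xor count k ω φ₄) (count-xor k ω _ φ₃) ⟩
  count k ω (λ z → (φ₁ z xor φ₂ z) xor φ₃ z) xor count k ω φ₄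
    ≡⟨ count-xor k ω _ φ₄ ⟩
  count k ω (λ z → ((φ₁ z xor φ₂ z) xor φ₃ z) xor φ₄ z)
    ≡⟨ count-false k ω _ (λ (N , M) → parity-cancellation N M (N ≡ᵇ + 2 *ℤ i mod l) (M ≡ᵇ + 2 *ℤ j mod l)) ⟩
  false
    ∎
  where
  open ≡-Reasoning
  l = suc (2 * m)
  [_] = theta l
  T₁ = (([ i ] ^ᵖ 4) ⊛ [ + 2 *ℤ j ]) k
  T₂ = (([ j ] ^ᵖ 4) ⊛ [ + 2 *ℤ i ]) k
  T₃ = ([ + 2 *ℤ i ] ⊛ [ + 2 *ℤ j ]) k
  T₄ = (([ i + j ] ^ᵖ 2) ⊛ ([ i - j ] ^ᵖ 2)) k
  ω = sq ⊞ sq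
  φ₁ = λ z → even (proj₁ z) ∧ z ≡² (+ 2 *ℤ i , + 2 *ℤ j) mod l
  φ₂ = λ z → even (proj₂ z) ∧ swap z ≡² (+ 2 *ℤ j , + 2 *ℤ i) mod l
  φ₃ = λ z → z ≡² (+ 2 *ℤ i , + 2 *ℤ j) mod l
  φ₄ = λ z → (proj₁ z ≡ᵇ proj₂ z mod 2) ∧ z ≡² (+ 2 *ℤ i , + 2 *ℤ j) mod l
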